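{- Given a $\mathbf{DLAL_B}$ derivation $\mathcal{D}$ of $\Gamma;\Delta\vdash t:A$ of depth $d$, the term $t$ can be decorated as a stratified term $t'$ of depth $d$ such that $\Gamma;\Delta\vdash t':A$ is derivable with the stratified typing rules.
   Context: System $\mathbf{DLAL_B}$. Types: $A,B::=\alpha\mid A\multimap B\mid A\Rightarrow B\mid \S A\mid \forall\alpha.A\mid \mathbf{Bool}$. Terms of $\Lambda_B$: $t,u,v::=x\mid F\mid T\mid \lambda x.t\mid t\,u\mid \mathrm{if}\ t\ \mathrm{then}\ u\ \mathrm{else}\ v$. Judgements are $\Gamma;\Delta\vdash t:A$ where $\Gamma$ (non-linear) and $\Delta$ (linear) assign types to distinct variables, with disjoint domains. Rules: (Id) $;x:A\vdash x:A$. ($\multimap$i) from $\Gamma;\Delta,x:A\vdash t:B$ infer $\Gamma;\Delta\vdash\lambda x.t:A\multimap B$. ($\multimap$e) from $\Gamma_1;\Delta_1\vdash t:A\multimap B$ and $\Gamma_2;\Delta_2\vdash u:A$ infer $\Gamma_1,\Gamma_2;\Delta_1,\Delta_2\vdash t\,u:B$. ($\Rightarrow$i) from $\Gamma,x:A;\Delta\vdash t:B$ infer $\Gamma;\Delta\vdash \lambda x.t:A\Rightarrow B$. ($\Rightarrow$e) from $\Gamma;\Delta\vdash t:A\Rightarrow B$ and $;z:C\vdash u:A$ infer $\Gamma,z:C;\Delta\vdash t\,u:B$ (the right premise may also be $;\vdash u:A$, with conclusion $\Gamma;\Delta\vdash t\,u:B$). (Weak) from $\Gamma_1;\Delta_1\vdash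 t:A$ infer $\Gamma_1,\Gamma_2;\Delta_1,\Delta_2\vdash t:A$. (Cntr) from $x_1:A,x_2:A,\Gamma;\Delta\vdash t:B$ infer $x:A,\Gamma;\Delta\vdash t[x/x_1,x/x_2]:B$. ($\S$i) from $;\Gamma,\Delta\vdash t:A$ infer $\Gamma;\S\Delta\vdash t:\S A$ ($\S\Delta$ prefixes $\S$ to every type of $\Delta$). ($\S$e) from $\Gamma_1;\Delta_1\vdash u:\S A$ and $\Gamma_2;x:\S A,\Delta_2\vdash t:B$ infer $\Gamma_1,\Gamma_2;\Delta_1,\Delta_2\vdash t[u/x]:B$. ($\forall$i) from $\Gamma;\Delta\vdash t:A$ infer $\Gamma;\Delta\vdash t:\forall\alpha.A$ if $\alpha$ is not free in $\Gamma,\Delta$. ($\forall$e) from $\Gamma;\Delta\vdash t:\forall\alpha.A$ infer $\Gamma;\Delta\vdash t:A[B/\alpha]$. ($B_0$i) $;\vdash F:\mathbf{Bool}$; ($B_1$i) $;\vdash T:\mathbf{Bool}$. ($B$e) from $\Gamma;\Delta\vdash M_0:\S^k\mathbf{Bool}$ ($k\in\mathbb{N}$), $\Gamma;\Delta\vdash M_1:A$, $\Gamma;\Delta\vdash M_2:A$ infer $\Gamma;\Delta\vdash \mathrm{if}\ M_0\ \mathrm{then}\ M_1\ \mathrm{else}\ M_2:A$. The depth of a derivation is the maximal number, along a branch, of premises of ($\S$i) rules and right-hand premises of ($\Rightarrow$e) rules. Stratified terms: terms of $\Lambda_B$ in which every abstraction is annotated by a natural number $k$ (its depth) and possibly also by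 $!$, written $\lambda^k x.t$ or $\lambda^{k!}x.t$, and every application is possibly annotated by $!$, written $t\,u$ or $t\,!\,u$. A decoration of $t$ is a stratified term whose erasure of annotations is $t$. $t[+1]$ is $t$ with the depth of every abstraction increased by $1$. The depth of a stratified term is the maximal depth of its abstractions. Stratified typing uses the rules above with these modifications: ($\multimap$i) concludes $\Gamma;\Delta\vdash\lambda^0x.t:A\multimap B$; ($\Rightarrow$i) concludes $\Gamma;\Delta\vdash\lambda^{0!}x.t:A\Rightarrow B$; ($\Rightarrow$e) concludes $\Gamma,z:C;\Delta\vdash t\,!\,u[+1]:B$; ($\S$i) concludes $\Gamma;\S\Delta\vdash t[+1]:\S A$. -}

module Defs where

open import Data.Nat using (ℕ; zero; suc; _⊔_; _≤_; _≟_)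
open import Data.Bool using (Bool; true; false; if_then_else_)
open import Data.Product using (_×_; _,_; proj₁; proj₂)
open import Data.List using (List; []; _∷_; _++_; map; concatMap; [_])
open import Data.List.Membership.Propositional using (_∈_; _∉_)
open import Data.List.Relation.Unary.Unique.Propositional using (Unique)
open import Data.List.Relation.Binary.Permutation.Propositional using (_↭_)
open import Relation.Nullary.Decidable using (does)

data Ty : Set where
  tv    : ℕ → Ty
  _⊸_   : Ty → Ty → Ty
  _⇒_   : Ty → Ty → Ty
  §     : Ty → Ty
  ∀'    : ℕ → Ty → Ty
  𝔹     : Ty

infixr 5 _⊸_ _⇒_

§^ : ℕ → Ty → Ty
§^ zero    A = A
§^ (suc k) A = § (§^ k A)

FTV : Ty → List ℕ
FTV (tv a)    = [ a ]
FTV (A ⊸ B)   = FTV A ++ FTV B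
FTV (A ⇒ B)   = FTV A ++ FTV B
FTV (§ A)     = FTV A
FTV (∀' a A)  = remove a (FTV A)
  where
  remove : ℕ → List ℕ → List ℕ
  remove a []       = []
  remove a (b ∷ bs) = if does (a ≟ b) then remove a bs else b ∷ remove a bs
FTV 𝔹         = []

BTV : Ty → List ℕ
BTV (tv a)    = []
BTV (A ⊸ B)   = BTV A ++ BTV B
BTV (A ⇒ B)   = BTV A ++ BTV B
BTV (§ A)     = BTV A
BTV (∀' a A)  = a ∷ BTV A
BTV 𝔹         = []

-- A[B/α] (substitution; used only when capture-free, see ∀e)
tsubst : Ty → ℕ → Ty → Ty
tsubst B a (tv b)    = if does (a ≟ b) then B else tv b
tsubst B a (C ⊸ D)   = tsubst B a C ⊸ tsubst B a D
tsubst B a (C ⇒ D)   = tsubst B a C ⇒ tsubst B a D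
tsubst B a (§ C)     = § (tsubst B a C)
tsubst B a (∀' b C)  = if does (a ≟ b) then ∀' b C else ∀' b (tsubst B a C)
tsubst B a 𝔹         = 𝔹

Ctx : Set
Ctx = List (ℕ × Ty)

§ctx : Ctx → Ctx
§ctx = map (λ p → proj₁ p , § (proj₂ p))

WF : Ctx → Ctx → Set
WF Γ Δ = Unique (map proj₁ (Γ ++ Δ))

FTVctx : Ctx → List ℕ
FTVctx = concatMap (λ p → FTV (proj₂ p))

Disjoint : List ℕ → List ℕ → Set
Disjoint xs ys = ∀ {y} → y ∈ xs → y ∉ ys

data Tm : Set where
  var  : ℕ → Tm
  F T  : Tm
  lam  : ℕ → Tm → Tm
  app  : Tm → Tm → Tm
  ite  : Tm → Tm → Tm → Tm

FV : Tm → List ℕ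
FV (var x)     = [ x ]
FV F           = []
FV T           = []
FV (lam x t)   = rm (FV t)
  where
  rm : List ℕ → List ℕ
  rm []       = []
  rm (y ∷ ys) = if does (x ≟ y) then rm ys else y ∷ rm ys
FV (app t u)   = FV t ++ FV u
FV (ite t u v) = FV t ++ FV u ++ FV v

BV : Tm → List ℕ
BV (var x)     = []
BV F           = []
BV T           = []
BV (lam x t)   = x ∷ BV t
BV (app t u)   = BV t ++ BV u
BV (ite t u v) = BV t ++ BV u ++ BV v

-- t[u/x]  (used only when capture-free)
subst : Tm → ℕ → Tm → Tm
subst u x (var y)     = if does (x ≟ y) then u else var y
subst u x F           = F
subst u x T           = T
subst u x (lam y t)   = if does (x ≟ y) then lam y t else lam y (subst u x t)
subst u x (app t v)   = app (subst u x t) (subst u x v)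
subst u x (ite t v w) = ite (subst u x t) (subst u x v) (subst u x w)

data Der : Ctx → Ctx → Tm → Ty → Set where
  Id   : ∀ {x A} → Der [] [ (x , A) ] (var x) A
  ⊸i   : ∀ {Γ Δ x t A B} → Der Γ (Δ ++ [ (x , A) ]) t B → Der Γ Δ (lam x t) (A ⊸ B)
  ⊸e   : ∀ {Γ₁ Γ₂ Δ₁ Δ₂ t u A B} → Der Γ₁ Δ₁ t (A ⊸ B) → Der Γ₂ Δ₂ u A →
         WF (Γ₁ ++ Γ₂) (Δ₁ ++ Δ₂) → Der (Γ₁ ++ Γ₂) (Δ₁ ++ Δ₂) (app t u) B
  ⇒i   : ∀ {Γ Δ x t A B} → Der (Γ ++ [ (x , A) ]) Δ t B → Der Γ Δ (lam x t) (A ⇒ B)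
  ⇒e   : ∀ {Γ Δ z C t u A B} → Der Γ Δ t (A ⇒ B) → Der [] [ (z , C) ] u A →
         WF (Γ ++ [ (z , C) ]) Δ → Der (Γ ++ [ (z , C) ]) Δ (app t u) B
  ⇒e₀  : ∀ {Γ Δ t u A B} → Der Γ Δ t (A ⇒ B) → Der [] [] u A → Der Γ Δ (app t u) B
  Weak : ∀ {Γ₁ Γ₂ Δ₁ Δ₂ t A} → Der Γ₁ Δ₁ t A →
         WF (Γ₁ ++ Γ₂) (Δ₁ ++ Δ₂) → Der (Γ₁ ++ Γ₂) (Δ₁ ++ Δ₂) t A
  Cntr : ∀ {Γ Δ x x₁ x₂ t A B} → Der ((x₁ , A) ∷ (x₂ , A) ∷ Γ) Δ t B →
         x ∉ BV t → WF ((x , A) ∷ Γ) Δ →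
         Der ((x , A) ∷ Γ) Δ (subst (var x) x₂ (subst (var x) x₁ t)) B
  §i   : ∀ {Γ Δ t A} → Der [] (Γ ++ Δ) t A → Der Γ (§ctx Δ) t (§ A)
  §e   : ∀ {Γ₁ Γ₂ Δ₁ Δ₂ x t u A B} → Der Γ₁ Δ₁ u (§ A) → Der Γ₂ ((x , § A) ∷ Δ₂) t B →
         Disjoint (BV t) (FV u) →
         WF (Γ₁ ++ Γ₂) (Δ₁ ++ Δ₂) → Der (Γ₁ ++ Γ₂) (Δ₁ ++ Δ₂) (subst u x t) B
  ∀i   : ∀ {Γ Δ t A α} → Der Γ Δ t A → α ∉ FTVctx (Γ ++ Δ) → Der Γ Δ t (∀' α A)
  ∀e   : ∀ {Γ Δ t A B α} → Der Γ Δ t (∀' α A) → Disjoint (BTV A) (FTV B) →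
         Der Γ Δ t (tsubst B α A)
  B₀i  : Der [] [] F 𝔹
  B₁i  : Der [] [] T 𝔹
  Be   : ∀ {Γ Δ M₀ M₁ M₂ A} k → Der Γ Δ M₀ (§^ k 𝔹) → Der Γ Δ M₁ A → Der Γ Δ M₂ A →
         Der Γ Δ (ite M₀ M₁ M₂) A
  -- contexts are sets of declarations: implicit exchange
  Perm : ∀ {Γ Γ' Δ Δ' t A} → Γ ↭ Γ' → Δ ↭ Δ' → Der Γ Δ t A → Der Γ' Δ' t A

depth : ∀ {Γ Δ t A} → Der Γ Δ t A → ℕ
depth Id             = 0
depth (⊸i D)         = depth D
depth (⊸e D E _)     = depth D ⊔ depth E
depth (⇒i D)         = depth D
depth (⇒e D E _)     = depth D ⊔ suc (depth E)
depth (⇒e₀ D E)      = depth D ⊔ suc (depth E)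
depth (Weak D _)     = depth D
depth (Cntr D _ _)   = depth D
depth (§i D)         = suc (depth D)
depth (§e D E _ _)   = depth D ⊔ depth E
depth (∀i D _)       = depth D
depth (∀e D _)       = depth D
depth B₀i            = 0
depth B₁i            = 0
depth (Be _ D E G)   = depth D ⊔ depth E ⊔ depth G
depth (Perm _ _ D)   = depth D

-- Stratified terms: lam k b x t is λ^k x.t (b = false) or λ^{k!} x.t (b = true);
-- app b t u is  t u (b = false) or  t ! u (b = true)

data STm : Set where
  var  : ℕ → STm
  F T  : STm
  lam  : ℕ → Bool → ℕ → STm → STm
  app  : Bool → STm → STm → STm
  ite  : STm → STm → STm → STm

erase : STm → Tm
erase (var x)       = var x
erase F             = F
erase T             = T
erase (lam _ _ x t) = lam x (erase t)
erase (app _ t u)   = app (erase t) (erase u)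
erase (ite t u v)   = ite (erase t) (erase u) (erase v)

shift : STm → STm
shift (var x)       = var x
shift F             = F
shift T             = T
shift (lam k b x t) = lam (suc k) b x (shift t)
shift (app b t u)   = app b (shift t) (shift u)
shift (ite t u v)   = ite (shift t) (shift u) (shift v)

sdepth : STm → ℕ
sdepth (var x)       = 0
sdepth F             = 0
sdepth T             = 0
sdepth (lam k _ _ t) = k ⊔ sdepth t
sdepth (app _ t u)   = sdepth t ⊔ sdepth u
sdepth (ite t u v)   = sdepth t ⊔ sdepth u ⊔ sdepth v

ssubst : STm → ℕ → STm → STm
ssubst u x (var y)       = if does (x ≟ y) then u else var y
ssubst u x F             = F
ssubst u x T             = T
ssubst u x (lam k b y t) = if does (x ≟ y) then lam k b y t else lam k b y (ssubst u x t)
ssubst u x (app b t v)   = app b (ssubst u x t) (ssubst u x v)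
ssubst u x (ite t v w)   = ite (ssubst u x t) (ssubst u x v) (ssubst u x w)

data SDer : Ctx → Ctx → STm → Ty → Set where
  Id   : ∀ {x A} → SDer [] [ (x , A) ] (var x) A
  ⊸i   : ∀ {Γ Δ x t A B} → SDer Γ (Δ ++ [ (x , A) ]) t B → SDer Γ Δ (lam 0 false x t) (A ⊸ B)
  ⊸e   : ∀ {Γ₁ Γ₂ Δ₁ Δ₂ t u A B} → SDer Γ₁ Δ₁ t (A ⊸ B) → SDer Γ₂ Δ₂ u A →
         WF (Γ₁ ++ Γ₂) (Δ₁ ++ Δ₂) → SDer (Γ₁ ++ Γ₂) (Δ₁ ++ Δ₂) (app false t u) B
  ⇒i   : ∀ {Γ Δ x t A B} → SDer (Γ ++ [ (x , A) ]) Δ t B → SDer Γ Δ (lam 0 true x t) (A ⇒ B)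
  ⇒e   : ∀ {Γ Δ z C t u A B} → SDer Γ Δ t (A ⇒ B) → SDer [] [ (z , C) ] u A →
         WF (Γ ++ [ (z , C) ]) Δ → SDer (Γ ++ [ (z , C) ]) Δ (app true t (shift u)) B
  ⇒e₀  : ∀ {Γ Δ t u A B} → SDer Γ Δ t (A ⇒ B) → SDer [] [] u A →
         SDer Γ Δ (app true t (shift u)) B
  Weak : ∀ {Γ₁ Γ₂ Δ₁ Δ₂ t A} → SDer Γ₁ Δ₁ t A →
         WF (Γ₁ ++ Γ₂) (Δ₁ ++ Δ₂) → SDer (Γ₁ ++ Γ₂) (Δ₁ ++ Δ₂) t A
  Cntr : ∀ {Γ Δ x x₁ x₂ t A B} → SDer ((x₁ , A) ∷ (x₂ , A) ∷ Γ) Δ t B →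
         x ∉ BV (erase t) → WF ((x , A) ∷ Γ) Δ →
         SDer ((x , A) ∷ Γ) Δ (ssubst (var x) x₂ (ssubst (var x) x₁ t)) B
  §i   : ∀ {Γ Δ t A} → SDer [] (Γ ++ Δ) t A → SDer Γ (§ctx Δ) (shift t) (§ A)
  §e   : ∀ {Γ₁ Γ₂ Δ₁ Δ₂ x t u A B} → SDer Γ₁ Δ₁ u (§ A) → SDer Γ₂ ((x , § A) ∷ Δ₂) t B →
         Disjoint (BV (erase t)) (FV (erase u)) →
         WF (Γ₁ ++ Γ₂) (Δ₁ ++ Δ₂) → SDer (Γ₁ ++ Γ₂) (Δ₁ ++ Δ₂) (ssubst u x t) B
  ∀i   : ∀ {Γ Δ t A α} → SDer Γ Δ t A → α ∉ FTVctx (Γ ++ Δ) → SDer Γ Δ t (∀' α A)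
  ∀e   : ∀ {Γ Δ t A B α} → SDer Γ Δ t (∀' α A) → Disjoint (BTV A) (FTV B) →
         SDer Γ Δ t (tsubst B α A)
  B₀i  : SDer [] [] F 𝔹
  B₁i  : SDer [] [] T 𝔹
  Be   : ∀ {Γ Δ M₀ M₁ M₂ A} k → SDer Γ Δ M₀ (§^ k 𝔹) → SDer Γ Δ M₁ A → SDer Γ Δ M₂ A →
         SDer Γ Δ (ite M₀ M₁ M₂) A
  Perm : ∀ {Γ Γ' Δ Δ' t A} → Γ ↭ Γ' → Δ ↭ Δ' → SDer Γ Δ t A → SDer Γ' Δ' t A

module Submission where

-- The proof is an induction on D in which every typing
-- rule is mirrored by the stratified rule of the same name; the only
-- non-trivial bookkeeping concerns the two term operations that the
-- stratified rules perform, the shift t[+1] (rules §i and ⇒e) and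
-- substitution (rules Cntr and §e).

open import Defs
open import Data.Nat using (ℕ; _≤_; _⊔_; suc; z≤n; s≤s; _≟_)
open import Data.Nat.Properties using (≤-trans; ⊔-lub; ⊔-mono-≤; ⊔-monoʳ-≤; m≤m⊔n; m≤n⊔m)
open import Data.Bool using (true; false)
open import Data.List using ([]; _∷_; _++_; [_])
open import Data.List.Membership.Propositional using (_∉_)
open import Data.Product using (Σ; _×_; _,_)
open import Relation.Nullary.Decidable using (does)
open import Relation.Binary.PropositionalEquality using (_≡_; refl; cong; cong₂)

-- The shift only changes annotations, so it is invisible after erasure.
erase-shift : ∀ t → erase (shift t) ≡ erase t
erase-shift (var x)       = refl
erase-shift F             = refl
erase-shift T             = refl
erase-shift (lam k b x t) = cong (lam x) (erase-shift t)
erase-shift (app b t u)   = cong₂ app (erase-shift t) (erase-shift u)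
erase-shift (ite t u v) rewrite erase-shift t | erase-shift u | erase-shift v = refl

-- The shift raises the depth by at most one (exactly one unless t has no
-- abstraction).  Note that suc m ⊔ suc n reduces to suc (m ⊔ n).
sdepth-shift : ∀ t → sdepth (shift t) ≤ suc (sdepth t)
sdepth-shift (var x)       = z≤n
sdepth-shift F             = z≤n
sdepth-shift T             = z≤n
sdepth-shift (lam k b x t) = ⊔-monoʳ-≤ (suc k) (sdepth-shift t)
sdepth-shift (app b t u)   = ⊔-mono-≤ (sdepth-shift t) (sdepth-shift u)
sdepth-shift (ite t u v)   = ⊔-mono-≤ (⊔-mono-≤ (sdepth-shift t) (sdepth-shift u)) (sdepth-shift v)

erase-ssubst : ∀ u x t → erase (ssubst u x t) ≡ subst (erase u) x (erase t)
erase-ssubst u x (var y) with does (x ≟ y)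
... | true  = refl
... | false = refl
erase-ssubst u x F = refl
erase-ssubst u x T = refl
erase-ssubst u x (lam k b y t) with does (x ≟ y)
... | true  = refl
... | false = cong (lam y) (erase-ssubst u x t)
erase-ssubst u x (app b t v) = cong₂ app (erase-ssubst u x t) (erase-ssubst u x v)
erase-ssubst u x (ite t v w)
  rewrite erase-ssubst u x t | erase-ssubst u x v | erase-ssubst u x w = refl

⊔-lub-under : ∀ n {a b c d} → a ≤ n ⊔ c → b ≤ n ⊔ d → a ⊔ b ≤ n ⊔ (c ⊔ d)
⊔-lub-under n a≤ b≤ =
  ⊔-lub (≤-trans a≤ (⊔-monoʳ-≤ n (m≤m⊔n _ _))) (≤-trans b≤ (⊔-monoʳ-≤ n (m≤n⊔m _ _)))

-- Substitution creates no new depth: every abstraction of ssubst u x t is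
-- an abstraction of u or of t.
sdepth-ssubst : ∀ u x t → sdepth (ssubst u x t) ≤ sdepth u ⊔ sdepth t
sdepth-ssubst u x (var y) with does (x ≟ y)
... | true  = m≤m⊔n _ _
... | false = z≤n
sdepth-ssubst u x F = z≤n
sdepth-ssubst u x T = z≤n
sdepth-ssubst u x (lam k b y t) with does (x ≟ y)
... | true  = m≤n⊔m (sdepth u) _
... | false = ⊔-lub-under (sdepth u) (m≤n⊔m (sdepth u) k) (sdepth-ssubst u x t)
sdepth-ssubst u x (app b t v) =
  ⊔-lub-under (sdepth u) (sdepth-ssubst u x t) (sdepth-ssubst u x v)
sdepth-ssubst u x (ite t v w) =
  ⊔-lub-under (sdepth u) (⊔-lub-under (sdepth u) (sdepth-ssubst u x t) (sdepth-ssubst u x v))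
                         (sdepth-ssubst u x w)

Decoration : Ctx → Ctx → Tm → Ty → ℕ → Set
Decoration Γ Δ t A d = Σ STm (λ t' → (erase t' ≡ t) × (sdepth t' ≤ d) × SDer Γ Δ t' A)

retype : ∀ {Γ Δ Γ' Δ' t A A' d} →
         (∀ {t'} → SDer Γ Δ t' A → SDer Γ' Δ' t' A') →
         Decoration Γ Δ t A d → Decoration Γ' Δ' t A' d
retype rule (t' , e , d , S) = t' , e , d , rule S

ssubst-decorates : ∀ {u t du dt} u' x t' →
                   erase u' ≡ u → sdepth u' ≤ du → erase t' ≡ t → sdepth t' ≤ dt →
                   (erase (ssubst u' x t') ≡ subst u x t) × (sdepth (ssubst u' x t') ≤ du ⊔ dt)
ssubst-decorates u' x t' refl u≤ refl t≤ =
  erase-ssubst u' x t' , ≤-trans (sdepth-ssubst u' x t') (⊔-mono-≤ u≤ t≤)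

decorate-⊸i : ∀ {Γ Δ x t A B d} → Decoration Γ (Δ ++ [ (x , A) ]) t B d →
              Decoration Γ Δ (lam x t) (A ⊸ B) d
decorate-⊸i (t' , refl , d , S) = lam 0 false _ t' , refl , d , ⊸i S

decorate-⇒i : ∀ {Γ Δ x t A B d} → Decoration (Γ ++ [ (x , A) ]) Δ t B d →
              Decoration Γ Δ (lam x t) (A ⇒ B) d
decorate-⇒i (t' , refl , d , S) = lam 0 true _ t' , refl , d , ⇒i S

decorate-⊸e : ∀ {Γ₁ Γ₂ Δ₁ Δ₂ t u A B dt du} →
              Decoration Γ₁ Δ₁ t (A ⊸ B) dt → Decoration Γ₂ Δ₂ u A du →
              WF (Γ₁ ++ Γ₂) (Δ₁ ++ Δ₂) → Decoration (Γ₁ ++ Γ₂) (Δ₁ ++ Δ₂) (app t u) B (dt ⊔ du)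
decorate-⊸e (t' , refl , dt , S) (u' , refl , du , U) wf =
  app false t' u' , refl , ⊔-mono-≤ dt du , ⊸e S U wf

-- The argument of a non-linear application is shifted, hence one level deeper.
shifted-argument : ∀ {t' u' u dt du} → erase u' ≡ u → sdepth t' ≤ dt → sdepth u' ≤ du →
                   (erase (app true t' (shift u')) ≡ app (erase t') u) ×
                   (sdepth (app true t' (shift u')) ≤ dt ⊔ suc du)
shifted-argument {t'} {u'} refl t≤ u≤ =
  cong (app (erase t')) (erase-shift u') , ⊔-mono-≤ t≤ (≤-trans (sdepth-shift u') (s≤s u≤))

decorate-⇒e : ∀ {Γ Δ z C t u A B dt du} →
              Decoration Γ Δ t (A ⇒ B) dt → Decoration [] [ (z , C) ] u A du →
              WF (Γ ++ [ (z , C) ]) Δ → Decoration (Γ ++ [ (z , C) ]) Δ (app t u) B (dt ⊔ suc du)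
decorate-⇒e (t' , refl , dt , S) (u' , eu , du , U) wf =
  let (e , d) = shifted-argument eu dt du in app true t' (shift u') , e , d , ⇒e S U wf

decorate-⇒e₀ : ∀ {Γ Δ t u A B dt du} →
               Decoration Γ Δ t (A ⇒ B) dt → Decoration [] [] u A du →
               Decoration Γ Δ (app t u) B (dt ⊔ suc du)
decorate-⇒e₀ (t' , refl , dt , S) (u' , eu , du , U) =
  let (e , d) = shifted-argument eu dt du in app true t' (shift u') , e , d , ⇒e₀ S U

decorate-Cntr : ∀ {Γ Δ x x₁ x₂ t A B d} → Decoration ((x₁ , A) ∷ (x₂ , A) ∷ Γ) Δ t B d →
                x ∉ BV t → WF ((x , A) ∷ Γ) Δ →
                Decoration ((x , A) ∷ Γ) Δ (subst (var x) x₂ (subst (var x) x₁ t)) B d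
decorate-Cntr {x = x} {x₁} {x₂} (t' , refl , d , S) nb wf =
  let (e₁ , d₁) = ssubst-decorates {du = 0} (var x) x₁ t' refl z≤n refl d
      (e₂ , d₂) = ssubst-decorates {du = 0} (var x) x₂ (ssubst (var x) x₁ t') refl z≤n e₁ d₁
  in ssubst (var x) x₂ (ssubst (var x) x₁ t') , e₂ , d₂ , Cntr S nb wf

decorate-§i : ∀ {Γ Δ t A d} → Decoration [] (Γ ++ Δ) t A d →
              Decoration Γ (§ctx Δ) t (§ A) (suc d)
decorate-§i (t' , refl , d , S) =
  shift t' , erase-shift t' , ≤-trans (sdepth-shift t') (s≤s d) , §i S

decorate-§e : ∀ {Γ₁ Γ₂ Δ₁ Δ₂ x t u A B du dt} →
              Decoration Γ₁ Δ₁ u (§ A) du → Decoration Γ₂ ((x , § A) ∷ Δ₂) t B dt →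
              Disjoint (BV t) (FV u) → WF (Γ₁ ++ Γ₂) (Δ₁ ++ Δ₂) →
              Decoration (Γ₁ ++ Γ₂) (Δ₁ ++ Δ₂) (subst u x t) B (du ⊔ dt)
decorate-§e {x = x} (u' , refl , du , U) (t' , refl , dt , S) dj wf =
  let (e , d) = ssubst-decorates u' x t' refl du refl dt in ssubst u' x t' , e , d , §e U S dj wf

decorate-Be : ∀ {Γ Δ M₀ M₁ M₂ A d₀ d₁ d₂} k →
              Decoration Γ Δ M₀ (§^ k 𝔹) d₀ → Decoration Γ Δ M₁ A d₁ → Decoration Γ Δ M₂ A d₂ →
              Decoration Γ Δ (ite M₀ M₁ M₂) A (d₀ ⊔ d₁ ⊔ d₂)
decorate-Be k (a , refl , d₀ , S₀) (b , refl , d₁ , S₁) (c , refl , d₂ , S₂) =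
  ite a b c , refl , ⊔-mono-≤ (⊔-mono-≤ d₀ d₁) d₂ , Be k S₀ S₁ S₂

lemma5 : ∀ {Γ Δ t A} (D : Der Γ Δ t A) →
    Σ STm (λ t' → (erase t' ≡ t) × (sdepth t' ≤ depth D) × SDer Γ Δ t' A)
lemma5 (Id {x})         = var x , refl , z≤n , Id
lemma5 (⊸i D)           = decorate-⊸i (lemma5 D)
lemma5 (⊸e D E wf)      = decorate-⊸e (lemma5 D) (lemma5 E) wf
lemma5 (⇒i D)           = decorate-⇒i (lemma5 D)
lemma5 (⇒e D E wf)      = decorate-⇒e (lemma5 D) (lemma5 E) wf
lemma5 (⇒e₀ D E)        = decorate-⇒e₀ (lemma5 D) (lemma5 E)
lemma5 (Weak D wf)      = retype (λ S → Weak S wf) (lemma5 D)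
lemma5 (Cntr D nb wf)   = decorate-Cntr (lemma5 D) nb wf
lemma5 (§i D)           = decorate-§i (lemma5 D)
lemma5 (§e D E dj wf)   = decorate-§e (lemma5 D) (lemma5 E) dj wf
lemma5 (∀i D fresh)     = retype (λ S → ∀i S fresh) (lemma5 D)
lemma5 (∀e D dj)        = retype (λ S → ∀e S dj) (lemma5 D)
lemma5 B₀i              = F , refl , z≤n , B₀i
lemma5 B₁i              = T , refl , z≤n , B₁i
lemma5 (Be k D E G)     = decorate-Be k (lemma5 D) (lemma5 E) (lemma5 G)
lemma5 (Perm p q D)     = retype (Perm p q) (lemma5 D)
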